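{- Let $n\ge3$ and let $\alpha_{ij}$ ($1\le i<j\le n$) be indeterminates. Let \[ P(x_1,\dots,x_n)=x_1^2+\cdots+x_n^2+\sum_{i<j}\alpha_{ij}x_ix_j, \] and for $i\in\{1,\dots,n\}$ define the rational transformation \[ F_i:(x_1,\dots,x_n)\mapsto\Bigl(x_1,\dots,x_{i-1},\frac{P|_{x_i=0}}{x_i},x_{i+1},\dots,x_n\Bigr). \] Then for any sequence of indices $i_1,\dots,i_m\in\{1,\dots,n\}$, the composition $G=F_{i_1}\circ\cdots\circ F_{i_m}$ has the form $G(x)=(G_1(x),\dots,G_n(x))$ where $G_1,\dots,G_n$ are Laurent polynomials in $x_1,\dots,x_n$ with coefficients in $\mathbb{Z}[\alpha_{ij}: i<j]$. -}

module Defs where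

open import Data.Nat using (ℕ; zero; suc; _<_)
open import Data.Integer using (ℤ; +_; -[1+_])
open import Data.Fin using (Fin; _≟_) renaming (zero to fz; suc to fs; _<_ to _<ᶠ_)
open import Data.Fin.Properties using (_<?_)
open import Data.List using (List; []; _∷_)
open import Data.Maybe using (Maybe; just; nothing; _>>=_)
open import Data.Product using (_×_; _,_)
open import Data.Rational using (ℚ; 0ℚ; 1ℚ; _+_; _*_; 1/_; ≢-nonZero; _/_)
import Data.Rational.Properties as ℚP
open import Relation.Nullary using (yes; no)

sumF : ∀ {n} → (Fin n → ℚ) → ℚ
sumF {zero}  f = 0ℚ
sumF {suc n} f = f fz + sumF (λ i → f (fs i))

prodF : ∀ {n} → (Fin n → ℚ) → ℚ
prodF {zero}  f = 1ℚ
prodF {suc n} f = f fz * prodF (λ i → f (fs i))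

_^ℕ_ : ℚ → ℕ → ℚ
q ^ℕ zero  = 1ℚ
q ^ℕ suc k = q * (q ^ℕ k)

-- Inverse in ℚ, made total by the (never used) convention 0⁻¹ = 0.
inv : ℚ → ℚ
inv q with q ℚP.≟ 0ℚ
... | yes _  = 0ℚ
... | no q≢0 = 1/_ q {{≢-nonZero q≢0}}

-- Integer powers in ℚ (only applied to nonzero bases below).
_^ℤ_ : ℚ → ℤ → ℚ
q ^ℤ (+ k)     = q ^ℕ k
q ^ℤ -[1+ k ]  = inv (q ^ℕ suc k)

-- A value of the parameters α_ij : only the entries with i < j are used.
Params : ℕ → Set
Params n = Fin n → Fin n → ℚ

Point : ℕ → Set
Point n = Fin n → ℚ

sumPairs : ∀ {n} → (Fin n → Fin n → ℚ) → ℚ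
sumPairs g = sumF (λ i → sumF (λ j → pick i j))
  where
  pick : _ → _ → ℚ
  pick i j with i <? j
  ... | yes _ = g i j
  ... | no _  = 0ℚ

prodPairs : ∀ {n} → (Fin n → Fin n → ℚ) → ℚ
prodPairs g = prodF (λ i → prodF (λ j → pick i j))
  where
  pick : _ → _ → ℚ
  pick i j with i <? j
  ... | yes _ = g i j
  ... | no _  = 1ℚ

P : ∀ {n} → Params n → Point n → ℚ
P α x = sumF (λ i → x i * x i) + sumPairs (λ i j → α i j * (x i * x j))

setAt : ∀ {n} → Fin n → ℚ → Point n → Point n
setAt i v x j with j ≟ i
... | yes _ = v
... | no _  = x j

F : ∀ {n} → Params n → Fin n → Point n → Maybe (Point n)
F α i x with x i ℚP.≟ 0ℚ
... | yes _ = nothing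
... | no _  = just (setAt i (P α (setAt i 0ℚ x) * inv (x i)) x)

-- (F_{i_1} ∘ ⋯ ∘ F_{i_m})(x) for the list [i_1, …, i_m]; F_{i_m} is applied first.
-- Result is nothing when some intermediate division is by zero.
G : ∀ {n} → Params n → List (Fin n) → Point n → Maybe (Point n)
G α []       x = just x
G α (i ∷ is) x = G α is x >>= F α i

-- Laurent polynomials in x_1,…,x_n with coefficients in ℤ[α_ij : i<j]:
-- finite lists of terms  c · Π_{i<j} α_ij^(a i j) · Π_k x_k^(e k)
-- with c ∈ ℤ, a i j ∈ ℕ (only entries i<j are used), e k ∈ ℤ.
Term : ℕ → Set
Term n = ℤ × (Fin n → Fin n → ℕ) × (Fin n → ℤ)

Laurent : ℕ → Set
Laurent n = List (Term n)

evalTerm : ∀ {n} → Params n → Point n → Term n → ℚ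
evalTerm α x (c , a , e) =
  (c / 1) * (prodPairs (λ i j → α i j ^ℕ a i j) * prodF (λ k → x k ^ℤ e k))

evalL : ∀ {n} → Params n → Point n → Laurent n → ℚ
evalL α x []       = 0ℚ
evalL α x (t ∷ ts) = evalTerm α x t + evalL α x ts

{-# OPTIONS --safe #-}

-- The ratio K = P(x) / (x₁ ⋯ xₙ) is invariant under every F_i. Indeed, write
-- P(z) = c + b z_i + z_i² with c = P|_{z_i=0} and b linear in the other coordinates.
-- Then P(z) = K z_i ∏_{k≠i} z_k is a monic quadratic equation in z_i whose two roots
-- are z_i and c / z_i (Vieta), so F_i replaces z_i by the other root
-- K ∏_{k≠i} z_k − b − z_i and keeps P(z) = K ∏_k z_k. This formula involves no
-- division except inside K, which is a Laurent polynomial in x, so by induction on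
-- the word every coordinate of G(x) is one. Nothing here uses n ≥ 3.

module Submission where

open import Defs
open import Data.Nat using (ℕ; _≤_)
open import Data.Fin using (Fin)
open import Data.List using (List)
open import Data.Maybe using (just)
open import Data.Product using (∃)
open import Data.Rational using (0ℚ)
open import Relation.Binary.PropositionalEquality using (_≡_; _≢_)

open import Data.Nat as ℕ using (zero; suc)
import Data.Nat.Properties as ℕ
open import Data.Integer as ℤ using (ℤ; +_; -[1+_]; _⊖_)
import Data.Integer.Properties as ℤ
open import Data.Fin using (_≟_) renaming (zero to fz; suc to fs; _<_ to _<ᶠ_)
open import Data.Fin.Properties using (_<?_; suc-injective; <-irrefl)
open import Data.Vec.Functional using (updateAt)
open import Data.Vec.Functional.Properties using (updateAt-updates; updateAt-minimal)
open import Data.List using ([]; _∷_; _++_; map)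
open import Data.Maybe using (nothing)
open import Data.Product using (Σ-syntax; _×_; _,_; proj₁; proj₂)
open import Data.Rational using (ℚ; 1ℚ; _+_; _*_; -_; _-_; _/_; mkℚ; 1/_; ≢-nonZero)
import Data.Rational.Properties as ℚ
import Data.Nat.Coprimality as Coprimality
open import Data.Rational.Solver using (module +-*-Solver)
open +-*-Solver
open import Function using (_∘_; const)
open import Relation.Nullary using (yes; no; contradiction)
open import Relation.Binary.PropositionalEquality
  using (refl; sym; trans; cong; cong₂; _≗_; module ≡-Reasoning)
open ≡-Reasoning

inv-≢0 : ∀ {p} (p≢0 : p ≢ 0ℚ) → inv p ≡ 1/_ p {{≢-nonZero p≢0}}
inv-≢0 {p} p≢0 with p ℚ.≟ 0ℚ
... | yes p≡0 = contradiction p≡0 p≢0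
... | no  _   = refl

inv-inverseʳ : ∀ {p} → p ≢ 0ℚ → p * inv p ≡ 1ℚ
inv-inverseʳ {p} p≢0 = trans (cong (p *_) (inv-≢0 p≢0)) (ℚ.*-inverseʳ p {{≢-nonZero p≢0}})

inv-cancelʳ : ∀ {p} q → p ≢ 0ℚ → (p * q) * inv p ≡ q
inv-cancelʳ {p} q p≢0 = begin
  (p * q) * inv p   ≡⟨ solve 3 (λ p q p⁻¹ → (p :* q) :* p⁻¹ := (p :* p⁻¹) :* q) refl p q (inv p) ⟩
  (p * inv p) * q   ≡⟨ cong (_* q) (inv-inverseʳ p≢0) ⟩
  1ℚ * q            ≡⟨ ℚ.*-identityˡ q ⟩
  q                 ∎

inv-unique : ∀ p q → p * q ≡ 1ℚ → inv p ≡ q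
inv-unique p q pq≡1 with p ℚ.≟ 0ℚ
... | yes refl = contradiction (trans (sym pq≡1) (ℚ.*-zeroˡ q)) ℚ.1≢0
... | no  p≢0  = begin
  1/ p             ≡⟨ ℚ.*-identityʳ (1/ p) ⟨
  1/ p * 1ℚ        ≡⟨ cong (1/ p *_) pq≡1 ⟨
  1/ p * (p * q)   ≡⟨ ℚ.*-assoc (1/ p) p q ⟨
  (1/ p * p) * q   ≡⟨ cong (_* q) (ℚ.*-inverseˡ p) ⟩
  1ℚ * q           ≡⟨ ℚ.*-identityˡ q ⟩
  q                ∎
  where instance _ = ≢-nonZero p≢0

-- Holds without side conditions because of the convention inv 0ℚ = 0ℚ.
inv-distrib-* : ∀ p q → inv (p * q) ≡ inv p * inv q
inv-distrib-* p q with p ℚ.≟ 0ℚ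
... | yes refl = trans (cong inv (ℚ.*-zeroˡ q)) (sym (ℚ.*-zeroˡ (inv q)))
... | no p≢0 with q ℚ.≟ 0ℚ
...   | yes refl = trans (cong inv (ℚ.*-zeroʳ p)) (sym (ℚ.*-zeroʳ (1/_ p {{≢-nonZero p≢0}})))
...   | no  q≢0  = inv-unique (p * q) (1/ p * 1/ q) (begin
  (p * q) * (1/ p * 1/ q)   ≡⟨ solve 4 (λ p q p⁻¹ q⁻¹ → (p :* q) :* (p⁻¹ :* q⁻¹) := (p :* p⁻¹) :* (q :* q⁻¹)) refl p q (1/ p) (1/ q) ⟩
  (p * 1/ p) * (q * 1/ q)   ≡⟨ cong₂ _*_ (ℚ.*-inverseʳ p) (ℚ.*-inverseʳ q) ⟩
  1ℚ                        ∎)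
  where instance
    _ = ≢-nonZero p≢0
    _ = ≢-nonZero q≢0

^ℕ-distribˡ-+-* : ∀ q a b → q ^ℕ (a ℕ.+ b) ≡ q ^ℕ a * q ^ℕ b
^ℕ-distribˡ-+-* q zero    b = sym (ℚ.*-identityˡ (q ^ℕ b))
^ℕ-distribˡ-+-* q (suc a) b = trans (cong (q *_) (^ℕ-distribˡ-+-* q a b)) (sym (ℚ.*-assoc q (q ^ℕ a) (q ^ℕ b)))

module _ {q : ℚ} (q≢0 : q ≢ 0ℚ) where

  ^ℤ-⊖ : ∀ a b → q ^ℤ (a ⊖ b) ≡ q ^ℕ a * inv (q ^ℕ b)
  ^ℤ-⊖ a       zero    = sym (ℚ.*-identityʳ (q ^ℕ a))
  ^ℤ-⊖ zero    (suc b) = sym (ℚ.*-identityˡ (inv (q ^ℕ suc b)))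
  ^ℤ-⊖ (suc a) (suc b) = begin
    q ^ℤ (suc a ⊖ suc b)                     ≡⟨ cong (q ^ℤ_) (ℤ.[1+m]⊖[1+n]≡m⊖n a b) ⟩
    q ^ℤ (a ⊖ b)                             ≡⟨ ^ℤ-⊖ a b ⟩
    q ^ℕ a * inv (q ^ℕ b)                    ≡⟨ inv-cancelʳ (q ^ℕ a * inv (q ^ℕ b)) q≢0 ⟨
    (q * (q ^ℕ a * inv (q ^ℕ b))) * inv q    ≡⟨ solve 4 (λ q a b q⁻¹ → (q :* (a :* b)) :* q⁻¹ := (q :* a) :* (q⁻¹ :* b)) refl q (q ^ℕ a) (inv (q ^ℕ b)) (inv q) ⟩
    (q * q ^ℕ a) * (inv q * inv (q ^ℕ b))    ≡⟨ cong ((q * q ^ℕ a) *_) (inv-distrib-* q (q ^ℕ b)) ⟨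
    q ^ℕ suc a * inv (q ^ℕ suc b)            ∎

  ^ℤ-distribˡ-+-* : ∀ m m′ → q ^ℤ (m ℤ.+ m′) ≡ q ^ℤ m * q ^ℤ m′
  ^ℤ-distribˡ-+-* (+ a)    (+ b)    = ^ℕ-distribˡ-+-* q a b
  ^ℤ-distribˡ-+-* (+ a)    -[1+ b ] = ^ℤ-⊖ a (suc b)
  ^ℤ-distribˡ-+-* -[1+ a ] (+ b)    = trans (^ℤ-⊖ b (suc a)) (ℚ.*-comm (q ^ℕ b) (inv (q ^ℕ suc a)))
  ^ℤ-distribˡ-+-* -[1+ a ] -[1+ b ] = begin
    inv (q ^ℕ suc (suc (a ℕ.+ b)))        ≡⟨ cong (λ k → inv (q ^ℕ suc k)) (ℕ.+-suc a b) ⟨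
    inv (q ^ℕ (suc a ℕ.+ suc b))          ≡⟨ cong inv (^ℕ-distribˡ-+-* q (suc a) (suc b)) ⟩
    inv (q ^ℕ suc a * q ^ℕ suc b)         ≡⟨ inv-distrib-* (q ^ℕ suc a) (q ^ℕ suc b) ⟩
    inv (q ^ℕ suc a) * inv (q ^ℕ suc b)   ∎

-- t and K p - b - t are the two roots of X² + (b - K p) X + c.
module _ {c b t K p : ℚ} (root : c + t * b + t * t ≡ K * (t * p)) where

  vieta-product : c ≡ t * (K * p - b - t)
  vieta-product = begin
    c                                     ≡⟨ solve 3 (λ c t b → c := (c :+ t :* b :+ t :* t) :- t :* b :- t :* t) refl c t b ⟩
    (c + t * b + t * t) - t * b - t * t   ≡⟨ cong (λ a → a - t * b - t * t) root ⟩
    K * (t * p) - t * b - t * t           ≡⟨ solve 4 (λ K t p b → K :* (t :* p) :- t :* b :- t :* t := t :* (K :* p :- b :- t)) refl K t p b ⟩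
    t * (K * p - b - t)                   ∎

  vieta-other-root : let w = K * p - b - t in c + w * b + w * w ≡ K * (w * p)
  vieta-other-root = begin
    c + w * b + w * w       ≡⟨ cong (λ a → a + w * b + w * w) vieta-product ⟩
    t * w + w * b + w * w   ≡⟨ solve 4 (λ K t p b → let w = K :* p :- b :- t in t :* w :+ w :* b :+ w :* w := K :* (w :* p)) refl K t p b ⟩
    K * (w * p)             ∎
    where
    w : ℚ
    w = K * p - b - t

sumF-cong : ∀ {m} {f g : Fin m → ℚ} → f ≗ g → sumF f ≡ sumF g
sumF-cong {zero}  f≗g = refl
sumF-cong {suc m} f≗g = cong₂ _+_ (f≗g fz) (sumF-cong (f≗g ∘ fs))

prodF-cong : ∀ {m} {f g : Fin m → ℚ} → f ≗ g → prodF f ≡ prodF g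
prodF-cong {zero}  f≗g = refl
prodF-cong {suc m} f≗g = cong₂ _*_ (f≗g fz) (prodF-cong (f≗g ∘ fs))

sumF-linear : ∀ {m} s t (f g h : Fin m → ℚ) →
              sumF (λ k → f k + s * g k + t * h k) ≡ sumF f + s * sumF g + t * sumF h
sumF-linear {zero}  s t f g h = solve 2 (λ s t → con 0ℚ := con 0ℚ :+ s :* con 0ℚ :+ t :* con 0ℚ) refl s t
sumF-linear {suc m} s t f g h = begin
  (f fz + s * g fz + t * h fz) + sumF (λ k → f (fs k) + s * g (fs k) + t * h (fs k))
    ≡⟨ cong (λ r → (f fz + s * g fz + t * h fz) + r) (sumF-linear s t (f ∘ fs) (g ∘ fs) (h ∘ fs)) ⟩
  (f fz + s * g fz + t * h fz) + (sumF (f ∘ fs) + s * sumF (g ∘ fs) + t * sumF (h ∘ fs))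
    ≡⟨ solve 8 (λ s t f₀ g₀ h₀ F G H → (f₀ :+ s :* g₀ :+ t :* h₀) :+ (F :+ s :* G :+ t :* H)
                                        := (f₀ :+ F) :+ s :* (g₀ :+ G) :+ t :* (h₀ :+ H))
               refl s t (f fz) (g fz) (h fz) (sumF (f ∘ fs)) (sumF (g ∘ fs)) (sumF (h ∘ fs)) ⟩
  (f fz + sumF (f ∘ fs)) + s * (g fz + sumF (g ∘ fs)) + t * (h fz + sumF (h ∘ fs))
    ∎

prodF-* : ∀ {m} (f g : Fin m → ℚ) → prodF (λ k → f k * g k) ≡ prodF f * prodF g
prodF-* {zero}  f g = refl
prodF-* {suc m} f g = begin
  (f fz * g fz) * prodF (λ k → f (fs k) * g (fs k))       ≡⟨ cong ((f fz * g fz) *_) (prodF-* (f ∘ fs) (g ∘ fs)) ⟩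
  (f fz * g fz) * (prodF (f ∘ fs) * prodF (g ∘ fs))       ≡⟨ solve 4 (λ a b c d → (a :* b) :* (c :* d) := (a :* c) :* (b :* d))
                                                                   refl (f fz) (g fz) (prodF (f ∘ fs)) (prodF (g ∘ fs)) ⟩
  (f fz * prodF (f ∘ fs)) * (g fz * prodF (g ∘ fs))       ∎

sumF-zero : ∀ {m} (f : Fin m → ℚ) → (∀ k → f k ≡ 0ℚ) → sumF f ≡ 0ℚ
sumF-zero {zero}  f f≡0 = refl
sumF-zero {suc m} f f≡0 = cong₂ _+_ (f≡0 fz) (sumF-zero (f ∘ fs) (f≡0 ∘ fs))

prodF-one : ∀ {m} (f : Fin m → ℚ) → (∀ k → f k ≡ 1ℚ) → prodF f ≡ 1ℚ
prodF-one {zero}  f f≡1 = refl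
prodF-one {suc m} f f≡1 = cong₂ _*_ (f≡1 fz) (prodF-one (f ∘ fs) (f≡1 ∘ fs))

sumF-single : ∀ {m} (f : Fin m → ℚ) k → (∀ j → j ≢ k → f j ≡ 0ℚ) → sumF f ≡ f k
sumF-single f fz     f≡0 = trans (cong (λ r → f fz + r) (sumF-zero (f ∘ fs) (λ j → f≡0 (fs j) λ ()))) (ℚ.+-identityʳ (f fz))
sumF-single f (fs k) f≡0 = trans (cong₂ _+_ (f≡0 fz λ ()) (sumF-single (f ∘ fs) k (λ j j≢k → f≡0 (fs j) (j≢k ∘ suc-injective))))
                                 (ℚ.+-identityˡ (f (fs k)))

prodF-single : ∀ {m} (f : Fin m → ℚ) k → (∀ j → j ≢ k → f j ≡ 1ℚ) → prodF f ≡ f k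
prodF-single f fz     f≡1 = trans (cong (f fz *_) (prodF-one (f ∘ fs) (λ j → f≡1 (fs j) λ ()))) (ℚ.*-identityʳ (f fz))
prodF-single f (fs k) f≡1 = trans (cong₂ _*_ (f≡1 fz λ ()) (prodF-single (f ∘ fs) k (λ j j≢k → f≡1 (fs j) (j≢k ∘ suc-injective))))
                                  (ℚ.*-identityˡ (f (fs k)))

-- Defs restricts the summands of sumPairs and the factors of prodPairs to i < j
-- through helpers local to where-blocks; unification with the unfolded
-- definitions gives them names here.
pairSummand : ∀ {n} → (Fin n → Fin n → ℚ) → Fin n → Fin n → ℚ
pairSummand {n} g = summand (refl {x = sumPairs g})
  where
  summand : ∀ {f : Fin n → Fin n → ℚ} → sumF (λ i → sumF (f i)) ≡ sumPairs g → Fin n → Fin n → ℚ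
  summand {f} _ = f

pairFactor : ∀ {n} → (Fin n → Fin n → ℚ) → Fin n → Fin n → ℚ
pairFactor {n} g = factor (refl {x = prodPairs g})
  where
  factor : ∀ {f : Fin n → Fin n → ℚ} → prodF (λ i → prodF (f i)) ≡ prodPairs g → Fin n → Fin n → ℚ
  factor {f} _ = f

module _ {n : ℕ} where

  sumPairs-cong : {g h : Fin n → Fin n → ℚ} → (∀ i j → i <ᶠ j → g i j ≡ h i j) → sumPairs g ≡ sumPairs h
  sumPairs-cong {g} {h} g≡h = sumF-cong (λ i → sumF-cong (summand-cong i))
    where
    summand-cong : ∀ i j → pairSummand g i j ≡ pairSummand h i j
    summand-cong i j with i <? j
    ... | yes i<j = g≡h i j i<j
    ... | no  _   = refl

  sumPairs-zero : (g : Fin n → Fin n → ℚ) → (∀ i j → i <ᶠ j → g i j ≡ 0ℚ) → sumPairs g ≡ 0ℚ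
  sumPairs-zero g g≡0 = sumF-zero _ (λ i → sumF-zero _ (summand-zero i))
    where
    summand-zero : ∀ i j → pairSummand g i j ≡ 0ℚ
    summand-zero i j with i <? j
    ... | yes i<j = g≡0 i j i<j
    ... | no  _   = refl

  sumPairs-linear : ∀ s t (f g h : Fin n → Fin n → ℚ) →
    sumPairs (λ i j → f i j + s * g i j + t * h i j) ≡ sumPairs f + s * sumPairs g + t * sumPairs h
  sumPairs-linear s t f g h = begin
    sumPairs (λ i j → f i j + s * g i j + t * h i j)
      ≡⟨ sumF-cong (λ i → sumF-cong (summand-linear i)) ⟩
    sumF (λ i → sumF (λ j → pairSummand f i j + s * pairSummand g i j + t * pairSummand h i j))
      ≡⟨ sumF-cong (λ i → sumF-linear s t (pairSummand f i) (pairSummand g i) (pairSummand h i)) ⟩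
    sumF (λ i → sumF (pairSummand f i) + s * sumF (pairSummand g i) + t * sumF (pairSummand h i))
      ≡⟨ sumF-linear s t (sumF ∘ pairSummand f) (sumF ∘ pairSummand g) (sumF ∘ pairSummand h) ⟩
    sumPairs f + s * sumPairs g + t * sumPairs h
      ∎
    where
    summand-linear : ∀ i j → pairSummand (λ i j → f i j + s * g i j + t * h i j) i j
                             ≡ pairSummand f i j + s * pairSummand g i j + t * pairSummand h i j
    summand-linear i j with i <? j
    ... | yes _ = refl
    ... | no  _ = solve 2 (λ s t → con 0ℚ := con 0ℚ :+ s :* con 0ℚ :+ t :* con 0ℚ) refl s t

  prodPairs-cong : {g h : Fin n → Fin n → ℚ} → (∀ i j → g i j ≡ h i j) → prodPairs g ≡ prodPairs h
  prodPairs-cong {g} {h} g≡h = prodF-cong (λ i → prodF-cong (factor-cong i))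
    where
    factor-cong : ∀ i j → pairFactor g i j ≡ pairFactor h i j
    factor-cong i j with i <? j
    ... | yes _ = g≡h i j
    ... | no  _ = refl

  prodPairs-* : (g h : Fin n → Fin n → ℚ) → prodPairs (λ i j → g i j * h i j) ≡ prodPairs g * prodPairs h
  prodPairs-* g h = begin
    prodPairs (λ i j → g i j * h i j)                                   ≡⟨ prodF-cong (λ i → prodF-cong (factor-* i)) ⟩
    prodF (λ i → prodF (λ j → pairFactor g i j * pairFactor h i j))     ≡⟨ prodF-cong (λ i → prodF-* (pairFactor g i) (pairFactor h i)) ⟩
    prodF (λ i → prodF (pairFactor g i) * prodF (pairFactor h i))       ≡⟨ prodF-* (prodF ∘ pairFactor g) (prodF ∘ pairFactor h) ⟩
    prodPairs g * prodPairs h                                           ∎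
    where
    factor-* : ∀ i j → pairFactor (λ i j → g i j * h i j) i j ≡ pairFactor g i j * pairFactor h i j
    factor-* i j with i <? j
    ... | yes _ = refl
    ... | no  _ = refl

  prodPairs-one : (g : Fin n → Fin n → ℚ) → (∀ i j → g i j ≡ 1ℚ) → prodPairs g ≡ 1ℚ
  prodPairs-one g g≡1 = prodF-one _ (λ i → prodF-one _ (factor-one i))
    where
    factor-one : ∀ i j → pairFactor g i j ≡ 1ℚ
    factor-one i j with i <? j
    ... | yes _ = g≡1 i j
    ... | no  _ = refl

  prodPairs-single : (g : Fin n → Fin n → ℚ) {k l : Fin n} → k <ᶠ l →
    (∀ i j → i ≢ k → g i j ≡ 1ℚ) → (∀ j → j ≢ l → g k j ≡ 1ℚ) → prodPairs g ≡ g k l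
  prodPairs-single g {k} {l} k<l off-row off-column = begin
    prodPairs g                ≡⟨ prodF-single _ k (λ i i≢k → prodF-one _ (λ j → factor-one i j (off-row i j i≢k))) ⟩
    prodF (pairFactor g k)     ≡⟨ prodF-single _ l (λ j j≢l → factor-one k j (off-column j j≢l)) ⟩
    pairFactor g k l           ≡⟨ factor-< ⟩
    g k l                      ∎
    where
    factor-one : ∀ i j → g i j ≡ 1ℚ → pairFactor g i j ≡ 1ℚ
    factor-one i j g≡1 with i <? j
    ... | yes _ = g≡1
    ... | no  _ = refl
    factor-< : pairFactor g k l ≡ g k l
    factor-< with k <? l
    ... | yes _   = refl
    ... | no  k≮l = contradiction k<l k≮l

  setAt-updates : ∀ i v (z : Point n) → setAt i v z i ≡ v
  setAt-updates i v z with i ≟ i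
  ... | yes _   = refl
  ... | no  i≢i = contradiction refl i≢i

  setAt-minimal : ∀ {i j} v (z : Point n) → j ≢ i → setAt i v z j ≡ z j
  setAt-minimal {i} {j} v z j≢i with j ≟ i
  ... | yes j≡i = contradiction j≡i j≢i
  ... | no  _   = refl

  setAt-cong : ∀ i {v v′} {z z′ : Point n} → v ≡ v′ → z ≗ z′ → setAt i v z ≗ setAt i v′ z′
  setAt-cong i v≡v′ z≗z′ j with j ≟ i
  ... | yes _ = v≡v′
  ... | no  _ = z≗z′ j

  setAt-id : ∀ i (z : Point n) → setAt i (z i) z ≗ z
  setAt-id i z j with j ≟ i
  ... | yes refl = refl
  ... | no  _    = refl

  unit : Fin n → Point n
  unit i = setAt i 1ℚ (const 0ℚ)

  setAt-line : ∀ i t (z : Point n) → setAt i t z ≗ (λ k → setAt i 0ℚ z k + t * unit i k)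
  setAt-line i t z k with k ≟ i
  ... | yes _ = solve 1 (λ t → t := con 0ℚ :+ t :* con 1ℚ) refl t
  ... | no  _ = solve 2 (λ t zₖ → zₖ := zₖ :+ t :* con 0ℚ) refl t (z k)

  prodF-setAt : ∀ i t (z : Point n) → prodF (setAt i t z) ≡ t * prodF (setAt i 1ℚ z)
  prodF-setAt i t z = begin
    prodF (setAt i t z)                                    ≡⟨ prodF-cong split ⟩
    prodF (λ k → setAt i t (const 1ℚ) k * setAt i 1ℚ z k)  ≡⟨ prodF-* (setAt i t (const 1ℚ)) (setAt i 1ℚ z) ⟩
    prodF (setAt i t (const 1ℚ)) * prodF (setAt i 1ℚ z)    ≡⟨ cong (_* prodF (setAt i 1ℚ z)) (prodF-single _ i (λ j → setAt-minimal t _)) ⟩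
    setAt i t (const 1ℚ) i * prodF (setAt i 1ℚ z)          ≡⟨ cong (_* prodF (setAt i 1ℚ z)) (setAt-updates i t _) ⟩
    t * prodF (setAt i 1ℚ z)                               ∎
    where
    split : ∀ k → setAt i t z k ≡ setAt i t (const 1ℚ) k * setAt i 1ℚ z k
    split k with k ≟ i
    ... | yes _ = sym (ℚ.*-identityʳ t)
    ... | no  _ = sym (ℚ.*-identityˡ (z k))

  P-cong : ∀ (α : Params n) {u v : Point n} → u ≗ v → P α u ≡ P α v
  P-cong α u≗v = cong₂ _+_ (sumF-cong (λ k → cong₂ _*_ (u≗v k) (u≗v k)))
                           (sumPairs-cong (λ k l _ → cong (α k l *_) (cong₂ _*_ (u≗v k) (u≗v l))))

  polar : Params n → Point n → Point n → ℚ
  polar α u v = sumF (λ k → u k * v k + v k * u k) + sumPairs (λ k l → α k l * (u k * v l + v k * u l))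

  polar-cong : ∀ (α : Params n) {u u′ v : Point n} → u ≗ u′ → polar α u v ≡ polar α u′ v
  polar-cong α {v = v} u≗u′ = cong₂ _+_
    (sumF-cong (λ k → cong (λ a → a * v k + v k * a) (u≗u′ k)))
    (sumPairs-cong (λ k l _ → cong₂ (λ a b → α k l * (a * v l + v k * b)) (u≗u′ k) (u≗u′ l)))

  P-line : ∀ α (u v : Point n) t → P α (λ k → u k + t * v k) ≡ P α u + t * polar α u v + t * t * P α v
  P-line α u v t = begin
    P α (λ k → u k + t * v k)
      ≡⟨ cong₂ _+_ (sumF-cong square) (sumPairs-cong (λ k l _ → cross k l)) ⟩
    sumF (λ k → uu k + t * uv k + t * t * vv k) + sumPairs (λ k l → αuu k l + t * αuv k l + t * t * αvv k l)
      ≡⟨ cong₂ _+_ (sumF-linear t (t * t) uu uv vv) (sumPairs-linear t (t * t) αuu αuv αvv) ⟩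
    (sumF uu + t * sumF uv + t * t * sumF vv) + (sumPairs αuu + t * sumPairs αuv + t * t * sumPairs αvv)
      ≡⟨ solve 7 (λ t a b c a′ b′ c′ → (a :+ t :* b :+ t :* t :* c) :+ (a′ :+ t :* b′ :+ t :* t :* c′)
                                        := (a :+ a′) :+ t :* (b :+ b′) :+ t :* t :* (c :+ c′))
               refl t (sumF uu) (sumF uv) (sumF vv) (sumPairs αuu) (sumPairs αuv) (sumPairs αvv) ⟩
    P α u + t * polar α u v + t * t * P α v
      ∎
    where
    uu uv vv : Fin n → ℚ
    uu k = u k * u k
    uv k = u k * v k + v k * u k
    vv k = v k * v k
    αuu αuv αvv : Fin n → Fin n → ℚ
    αuu k l = α k l * (u k * u l)
    αuv k l = α k l * (u k * v l + v k * u l)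
    αvv k l = α k l * (v k * v l)
    square : ∀ k → (u k + t * v k) * (u k + t * v k) ≡ uu k + t * uv k + t * t * vv k
    square k = solve 3 (λ t a b → (a :+ t :* b) :* (a :+ t :* b) := a :* a :+ t :* (a :* b :+ b :* a) :+ t :* t :* (b :* b))
                       refl t (u k) (v k)
    cross : ∀ k l → α k l * ((u k + t * v k) * (u l + t * v l)) ≡ αuu k l + t * αuv k l + t * t * αvv k l
    cross k l = solve 6 (λ t c a b a′ b′ → c :* ((a :+ t :* b) :* (a′ :+ t :* b′))
                                          := c :* (a :* a′) :+ t :* (c :* (a :* b′ :+ b :* a′)) :+ t :* t :* (c :* (b :* b′)))
                        refl t (α k l) (u k) (v k) (u l) (v l)

  P-unit : ∀ α i → P α (unit i) ≡ 1ℚ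
  P-unit α i = cong₂ _+_ squares products
    where
    squares : sumF (λ k → unit i k * unit i k) ≡ 1ℚ
    squares = trans (sumF-single _ i (λ j j≢i → cong (λ a → a * a) (setAt-minimal 1ℚ _ j≢i)))
                    (cong (λ a → a * a) (setAt-updates i 1ℚ _))
    products : sumPairs (λ k l → α k l * (unit i k * unit i l)) ≡ 0ℚ
    products = sumPairs-zero _ off-diagonal
      where
      off-diagonal : ∀ k l → k <ᶠ l → α k l * (unit i k * unit i l) ≡ 0ℚ
      off-diagonal k l k<l with k ≟ i
      ... | no  _    = trans (cong (α k l *_) (ℚ.*-zeroˡ (unit i l))) (ℚ.*-zeroʳ (α k l))
      ... | yes refl = trans (cong (λ a → α k l * (1ℚ * a)) (setAt-minimal 1ℚ _ (λ l≡k → <-irrefl (sym l≡k) k<l)))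
                             (trans (cong (α k l *_) (ℚ.*-zeroʳ 1ℚ)) (ℚ.*-zeroʳ (α k l)))

  linearCoeff : Params n → Fin n → Point n → ℚ
  linearCoeff α i z = polar α (setAt i 0ℚ z) (unit i)

  P-setAt : ∀ α i t (z : Point n) → P α (setAt i t z) ≡ P α (setAt i 0ℚ z) + t * linearCoeff α i z + t * t
  P-setAt α i t z = begin
    P α (setAt i t z)                                                  ≡⟨ P-cong α (setAt-line i t z) ⟩
    P α (λ k → setAt i 0ℚ z k + t * unit i k)                          ≡⟨ P-line α (setAt i 0ℚ z) (unit i) t ⟩
    P α (setAt i 0ℚ z) + t * linearCoeff α i z + t * t * P α (unit i)  ≡⟨ cong (λ a → P α (setAt i 0ℚ z) + t * linearCoeff α i z + t * t * a) (P-unit α i) ⟩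
    P α (setAt i 0ℚ z) + t * linearCoeff α i z + t * t * 1ℚ            ≡⟨ cong (λ a → P α (setAt i 0ℚ z) + t * linearCoeff α i z + a) (ℚ.*-identityʳ (t * t)) ⟩
    P α (setAt i 0ℚ z) + t * linearCoeff α i z + t * t                 ∎

  F-just : ∀ α i (z : Point n) {y} → F α i z ≡ just y →
           z i ≢ 0ℚ × y ≡ setAt i (P α (setAt i 0ℚ z) * inv (z i)) z
  F-just α i z F≡y with z i ℚ.≟ 0ℚ | F≡y
  ... | no zi≢0 | refl = zi≢0 , cong (λ r → setAt i (P α (setAt i 0ℚ z) * r) z) (inv-≢0 zi≢0)

  vietaMove : ℚ → Params n → Fin n → Point n → Point n
  vietaMove K α i z = setAt i (K * prodF (setAt i 1ℚ z) - linearCoeff α i z - z i) z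

  vietaMove-cong : ∀ K α i {z z′ : Point n} → z ≗ z′ → vietaMove K α i z ≗ vietaMove K α i z′
  vietaMove-cong K α i z≗z′ = setAt-cong i
    (cong₂ _-_ (cong₂ (λ a b → K * a - b) (prodF-cong (setAt-cong i refl z≗z′)) (polar-cong α (setAt-cong i refl z≗z′)))
               (z≗z′ i))
    z≗z′

  F-vieta : ∀ K α i (z : Point n) {y} → P α z ≡ K * prodF z → F α i z ≡ just y →
            y ≗ vietaMove K α i z × P α y ≡ K * prodF y
  F-vieta K α i z P≡K∏ F≡y with F-just α i z F≡y
  ... | zi≢0 , refl = setAt-cong i v≡w (λ _ → refl) , (begin
    P α (setAt i v z)         ≡⟨ cong (λ a → P α (setAt i a z)) v≡w ⟩
    P α (setAt i w z)         ≡⟨ P-setAt α i w z ⟩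
    c + w * b + w * w         ≡⟨ vieta-other-root {c} {b} {z i} {K} {p} root ⟩
    K * (w * p)               ≡⟨ cong (K *_) (prodF-setAt i w z) ⟨
    K * prodF (setAt i w z)   ≡⟨ cong (λ a → K * prodF (setAt i a z)) v≡w ⟨
    K * prodF (setAt i v z)   ∎)
    where
    c b p v w : ℚ
    c = P α (setAt i 0ℚ z)
    b = linearCoeff α i z
    p = prodF (setAt i 1ℚ z)
    v = c * inv (z i)
    w = K * p - b - z i
    root : c + z i * b + z i * z i ≡ K * (z i * p)
    root = begin
      c + z i * b + z i * z i       ≡⟨ P-setAt α i (z i) z ⟨
      P α (setAt i (z i) z)         ≡⟨ P-cong α (setAt-id i z) ⟩
      P α z                         ≡⟨ P≡K∏ ⟩
      K * prodF z                   ≡⟨ cong (K *_) (prodF-cong (setAt-id i z)) ⟨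
      K * prodF (setAt i (z i) z)   ≡⟨ cong (K *_) (prodF-setAt i (z i) z) ⟩
      K * (z i * p)                 ∎
    v≡w : v ≡ w
    v≡w = trans (cong (_* inv (z i)) (vieta-product {c} {b} {z i} {K} {p} root)) (inv-cancelʳ w zi≢0)

  markovRatio : Params n → Point n → ℚ
  markovRatio α x = P α x * prodF (λ k → inv (x k))

  P-markovRatio : ∀ α (x : Point n) → (∀ k → x k ≢ 0ℚ) → P α x ≡ markovRatio α x * prodF x
  P-markovRatio α x x≢0 = begin
    P α x                                            ≡⟨ ℚ.*-identityʳ (P α x) ⟨
    P α x * 1ℚ                                       ≡⟨ cong (P α x *_) (prodF-one _ (λ k → inv-inverseʳ (x≢0 k))) ⟨
    P α x * prodF (λ k → x k * inv (x k))            ≡⟨ cong (P α x *_) (prodF-* x (λ k → inv (x k))) ⟩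
    P α x * (prodF x * prodF (λ k → inv (x k)))      ≡⟨ solve 3 (λ a b c → a :* (b :* c) := (a :* c) :* b) refl (P α x) (prodF x) (prodF (λ k → inv (x k))) ⟩
    markovRatio α x * prodF x                        ∎

  vietaOrbit : List (Fin n) → Params n → Point n → Point n
  vietaOrbit []       α x = x
  vietaOrbit (i ∷ is) α x = vietaMove (markovRatio α x) α i (vietaOrbit is α x)

  G-vietaOrbit : ∀ is α (x : Point n) → (∀ k → x k ≢ 0ℚ) → ∀ {y} → G α is x ≡ just y →
                 y ≗ vietaOrbit is α x × P α y ≡ markovRatio α x * prodF y
  G-vietaOrbit []       α x x≢0 refl = (λ _ → refl) , P-markovRatio α x x≢0
  G-vietaOrbit (i ∷ is) α x x≢0 G≡y with G α is x in G≡z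
  G-vietaOrbit (i ∷ is) α x x≢0 () | nothing
  ... | just z with G-vietaOrbit is α x x≢0 G≡z
  ...   | z≗orbit , Pz with F-vieta (markovRatio α x) α i z Pz G≡y
  ...     | y≗move , Py = (λ j → trans (y≗move j) (vietaMove-cong (markovRatio α x) α i z≗orbit j)) , Py

-- c / 1 normalises to the integral rational mkℚ c 0, and a product of two
-- integral rationals computes to (c ℤ.* d) / 1.
/1-* : ∀ c d → (c ℤ.* d) / 1 ≡ (c / 1) * (d / 1)
/1-* c d = sym (cong₂ _*_ (integral c) (integral d))
  where
  integral : ∀ c → c / 1 ≡ mkℚ c 0 (Coprimality.sym (Coprimality.1-coprimeTo ℤ.∣ c ∣))
  integral c = ℚ.↥p/↧p≡p (mkℚ c 0 (Coprimality.sym (Coprimality.1-coprimeTo ℤ.∣ c ∣)))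

module _ {n : ℕ} where

  IsLaurent : (Params n → Point n → ℚ) → Set
  IsLaurent f = Σ[ L ∈ Laurent n ] (∀ α x → (∀ k → x k ≢ 0ℚ) → f α x ≡ evalL α x L)

  IsLaurent-cong : {f g : Params n → Point n → ℚ} → (∀ α x → (∀ k → x k ≢ 0ℚ) → f α x ≡ g α x) →
                   IsLaurent f → IsLaurent g
  IsLaurent-cong f≡g (L , f≡L) = L , λ α x x≢0 → trans (sym (f≡g α x x≢0)) (f≡L α x x≢0)

  evalL-++ : ∀ α x (L L′ : Laurent n) → evalL α x (L ++ L′) ≡ evalL α x L + evalL α x L′
  evalL-++ α x []      L′ = sym (ℚ.+-identityˡ (evalL α x L′))
  evalL-++ α x (t ∷ L) L′ = trans (cong (λ a → evalTerm α x t + a) (evalL-++ α x L L′))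
                                  (sym (ℚ.+-assoc (evalTerm α x t) (evalL α x L) (evalL α x L′)))

  _*ᵗ_ : Term n → Term n → Term n
  (c , a , e) *ᵗ (c′ , a′ , e′) = c ℤ.* c′ , (λ i j → a i j ℕ.+ a′ i j) , (λ k → e k ℤ.+ e′ k)

  evalTerm-* : ∀ α x → (∀ k → x k ≢ 0ℚ) → ∀ t t′ → evalTerm α x (t *ᵗ t′) ≡ evalTerm α x t * evalTerm α x t′
  evalTerm-* α x x≢0 (c , a , e) (c′ , a′ , e′) = begin
    (c ℤ.* c′) / 1 * (prodPairs (λ i j → α i j ^ℕ (a i j ℕ.+ a′ i j)) * prodF (λ k → x k ^ℤ (e k ℤ.+ e′ k)))
      ≡⟨ cong₂ _*_ (/1-* c c′) (cong₂ _*_ params vars) ⟩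
    ((c / 1) * (c′ / 1)) * ((A * A′) * (X * X′))
      ≡⟨ solve 6 (λ c c′ A A′ X X′ → (c :* c′) :* ((A :* A′) :* (X :* X′)) := (c :* (A :* X)) :* (c′ :* (A′ :* X′)))
                 refl (c / 1) (c′ / 1) A A′ X X′ ⟩
    (c / 1 * (A * X)) * (c′ / 1 * (A′ * X′))
      ∎
    where
    A A′ X X′ : ℚ
    A  = prodPairs (λ i j → α i j ^ℕ a i j)
    A′ = prodPairs (λ i j → α i j ^ℕ a′ i j)
    X  = prodF (λ k → x k ^ℤ e k)
    X′ = prodF (λ k → x k ^ℤ e′ k)
    params : prodPairs (λ i j → α i j ^ℕ (a i j ℕ.+ a′ i j)) ≡ A * A′
    params = trans (prodPairs-cong (λ i j → ^ℕ-distribˡ-+-* (α i j) (a i j) (a′ i j)))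
                   (prodPairs-* (λ i j → α i j ^ℕ a i j) (λ i j → α i j ^ℕ a′ i j))
    vars : prodF (λ k → x k ^ℤ (e k ℤ.+ e′ k)) ≡ X * X′
    vars = trans (prodF-cong (λ k → ^ℤ-distribˡ-+-* (x≢0 k) (e k) (e′ k)))
                 (prodF-* (λ k → x k ^ℤ e k) (λ k → x k ^ℤ e′ k))

  _*ᴸ_ : Laurent n → Laurent n → Laurent n
  []      *ᴸ L′ = []
  (t ∷ L) *ᴸ L′ = map (t *ᵗ_) L′ ++ (L *ᴸ L′)

  evalL-*ᵗ : ∀ α x → (∀ k → x k ≢ 0ℚ) → ∀ t (L : Laurent n) → evalL α x (map (t *ᵗ_) L) ≡ evalTerm α x t * evalL α x L
  evalL-*ᵗ α x x≢0 t []       = sym (ℚ.*-zeroʳ (evalTerm α x t))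
  evalL-*ᵗ α x x≢0 t (t′ ∷ L) = begin
    evalTerm α x (t *ᵗ t′) + evalL α x (map (t *ᵗ_) L)              ≡⟨ cong₂ _+_ (evalTerm-* α x x≢0 t t′) (evalL-*ᵗ α x x≢0 t L) ⟩
    evalTerm α x t * evalTerm α x t′ + evalTerm α x t * evalL α x L  ≡⟨ ℚ.*-distribˡ-+ (evalTerm α x t) (evalTerm α x t′) (evalL α x L) ⟨
    evalTerm α x t * (evalTerm α x t′ + evalL α x L)                 ∎

  evalL-* : ∀ α x → (∀ k → x k ≢ 0ℚ) → ∀ (L L′ : Laurent n) → evalL α x (L *ᴸ L′) ≡ evalL α x L * evalL α x L′
  evalL-* α x x≢0 []      L′ = sym (ℚ.*-zeroˡ (evalL α x L′))
  evalL-* α x x≢0 (t ∷ L) L′ = begin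
    evalL α x (map (t *ᵗ_) L′ ++ (L *ᴸ L′))                      ≡⟨ evalL-++ α x (map (t *ᵗ_) L′) (L *ᴸ L′) ⟩
    evalL α x (map (t *ᵗ_) L′) + evalL α x (L *ᴸ L′)             ≡⟨ cong₂ _+_ (evalL-*ᵗ α x x≢0 t L′) (evalL-* α x x≢0 L L′) ⟩
    evalTerm α x t * evalL α x L′ + evalL α x L * evalL α x L′   ≡⟨ ℚ.*-distribʳ-+ (evalL α x L′) (evalTerm α x t) (evalL α x L) ⟨
    (evalTerm α x t + evalL α x L) * evalL α x L′                ∎

  IsLaurent-+ : {f g : Params n → Point n → ℚ} → IsLaurent f → IsLaurent g → IsLaurent (λ α x → f α x + g α x)
  IsLaurent-+ (L , f≡L) (L′ , g≡L′) =
    L ++ L′ , λ α x x≢0 → trans (cong₂ _+_ (f≡L α x x≢0) (g≡L′ α x x≢0)) (sym (evalL-++ α x L L′))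

  IsLaurent-* : {f g : Params n → Point n → ℚ} → IsLaurent f → IsLaurent g → IsLaurent (λ α x → f α x * g α x)
  IsLaurent-* (L , f≡L) (L′ , g≡L′) =
    L *ᴸ L′ , λ α x x≢0 → trans (cong₂ _*_ (f≡L α x x≢0) (g≡L′ α x x≢0)) (sym (evalL-* α x x≢0 L L′))

  IsLaurent-monomial : ∀ t → IsLaurent (λ α x → evalTerm α x t)
  IsLaurent-monomial t = t ∷ [] , λ α x _ → sym (ℚ.+-identityʳ (evalTerm α x t))

  IsLaurent-const : ∀ c → IsLaurent (λ _ _ → c / 1)
  IsLaurent-const c = IsLaurent-cong eval (IsLaurent-monomial (c , (λ _ _ → 0) , (λ _ → + 0)))
    where
    eval : ∀ α x → (∀ k → x k ≢ 0ℚ) → c / 1 * (prodPairs (λ i j → α i j ^ℕ 0) * prodF (λ k → x k ^ℤ (+ 0))) ≡ c / 1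
    eval α x _ = trans (cong (λ a → c / 1 * a) (cong₂ _*_ (prodPairs-one (λ i j → α i j ^ℕ 0) (λ _ _ → refl)) (prodF-one (λ k → x k ^ℤ (+ 0)) (λ _ → refl))))
                       (ℚ.*-identityʳ (c / 1))

  IsLaurent-^ℤ : ∀ k e → IsLaurent (λ α x → x k ^ℤ e)
  IsLaurent-^ℤ k e = IsLaurent-cong eval (IsLaurent-monomial (+ 1 , (λ _ _ → 0) , exponent))
    where
    exponent : Fin n → ℤ
    exponent = updateAt (const (+ 0)) k (const e)
    eval : ∀ α x → (∀ k → x k ≢ 0ℚ) → 1ℚ * (prodPairs (λ i j → α i j ^ℕ 0) * prodF (λ j → x j ^ℤ exponent j)) ≡ x k ^ℤ e
    eval α x _ = begin
      1ℚ * (prodPairs (λ i j → α i j ^ℕ 0) * prodF (λ j → x j ^ℤ exponent j))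
        ≡⟨ cong (λ a → 1ℚ * (a * prodF (λ j → x j ^ℤ exponent j))) (prodPairs-one (λ i j → α i j ^ℕ 0) (λ _ _ → refl)) ⟩
      1ℚ * (1ℚ * prodF (λ j → x j ^ℤ exponent j))
        ≡⟨ trans (ℚ.*-identityˡ _) (ℚ.*-identityˡ _) ⟩
      prodF (λ j → x j ^ℤ exponent j)
        ≡⟨ prodF-single _ k (λ j j≢k → cong (x j ^ℤ_) (updateAt-minimal j k (const (+ 0)) j≢k)) ⟩
      x k ^ℤ exponent k
        ≡⟨ cong (x k ^ℤ_) (updateAt-updates k (const (+ 0))) ⟩
      x k ^ℤ e
        ∎

  IsLaurent-var : ∀ k → IsLaurent (λ α x → x k)
  IsLaurent-var k = IsLaurent-cong (λ α x _ → ℚ.*-identityʳ (x k)) (IsLaurent-^ℤ k (+ 1))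

  IsLaurent-inv-var : ∀ k → IsLaurent (λ α x → inv (x k))
  IsLaurent-inv-var k = IsLaurent-cong (λ α x _ → cong inv (ℚ.*-identityʳ (x k))) (IsLaurent-^ℤ k -[1+ 0 ])

  IsLaurent-param : ∀ {k l} → k <ᶠ l → IsLaurent (λ α x → α k l)
  IsLaurent-param {k} {l} k<l = IsLaurent-cong eval (IsLaurent-monomial (+ 1 , exponent , (λ _ → + 0)))
    where
    exponent : Fin n → Fin n → ℕ
    exponent = updateAt (λ _ _ → 0) k (λ row → updateAt row l (const 1))
    eval : ∀ α x → (∀ k → x k ≢ 0ℚ) → 1ℚ * (prodPairs (λ i j → α i j ^ℕ exponent i j) * prodF (λ j → x j ^ℤ (+ 0))) ≡ α k l
    eval α x _ = begin
      1ℚ * (prodPairs (λ i j → α i j ^ℕ exponent i j) * prodF (λ j → x j ^ℤ (+ 0)))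
        ≡⟨ cong (λ a → 1ℚ * (prodPairs (λ i j → α i j ^ℕ exponent i j) * a)) (prodF-one (λ j → x j ^ℤ (+ 0)) (λ _ → refl)) ⟩
      1ℚ * (prodPairs (λ i j → α i j ^ℕ exponent i j) * 1ℚ)
        ≡⟨ trans (ℚ.*-identityˡ _) (ℚ.*-identityʳ _) ⟩
      prodPairs (λ i j → α i j ^ℕ exponent i j)
        ≡⟨ prodPairs-single _ k<l (λ i j i≢k → cong (λ row → α i j ^ℕ row j) (updateAt-minimal i k (λ _ _ → 0) i≢k))
                                  (λ j j≢l → cong (α k j ^ℕ_) (trans (cong (λ row → row j) (updateAt-updates k (λ _ _ → 0)))
                                                                     (updateAt-minimal j l (const 0) j≢l))) ⟩
      α k l ^ℕ exponent k l
        ≡⟨ cong (α k l ^ℕ_) (trans (cong (λ row → row l) (updateAt-updates k (λ _ _ → 0))) (updateAt-updates l (const 0))) ⟩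
      α k l * 1ℚ
        ≡⟨ ℚ.*-identityʳ (α k l) ⟩
      α k l
        ∎

  IsLaurent-neg : {f : Params n → Point n → ℚ} → IsLaurent f → IsLaurent (λ α x → - f α x)
  IsLaurent-neg {f} f-Laurent = IsLaurent-cong minus-one (IsLaurent-* (IsLaurent-const -[1+ 0 ]) f-Laurent)
    where
    minus-one : ∀ α x → (∀ k → x k ≢ 0ℚ) → -[1+ 0 ] / 1 * f α x ≡ - f α x
    minus-one α x _ = solve 1 (λ a → con (-[1+ 0 ] / 1) :* a := :- a) refl (f α x)

  IsLaurent-minus : {f g : Params n → Point n → ℚ} → IsLaurent f → IsLaurent g → IsLaurent (λ α x → f α x - g α x)
  IsLaurent-minus f-Laurent g-Laurent = IsLaurent-+ f-Laurent (IsLaurent-neg g-Laurent)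

  IsLaurent-sumF : ∀ {m} {f : Params n → Point n → Fin m → ℚ} →
                   (∀ k → IsLaurent (λ α x → f α x k)) → IsLaurent (λ α x → sumF (f α x))
  IsLaurent-sumF {zero}  _         = [] , λ _ _ _ → refl
  IsLaurent-sumF {suc m} f-Laurent = IsLaurent-+ (f-Laurent fz) (IsLaurent-sumF (f-Laurent ∘ fs))

  IsLaurent-prodF : ∀ {m} {f : Params n → Point n → Fin m → ℚ} →
                    (∀ k → IsLaurent (λ α x → f α x k)) → IsLaurent (λ α x → prodF (f α x))
  IsLaurent-prodF {zero}  _         = IsLaurent-const (+ 1)
  IsLaurent-prodF {suc m} f-Laurent = IsLaurent-* (f-Laurent fz) (IsLaurent-prodF (f-Laurent ∘ fs))

  IsLaurent-sumPairs : {g : Params n → Point n → Fin n → Fin n → ℚ} →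
                       (∀ i j → i <ᶠ j → IsLaurent (λ α x → g α x i j)) → IsLaurent (λ α x → sumPairs (g α x))
  IsLaurent-sumPairs {g} g-Laurent = IsLaurent-sumF (λ i → IsLaurent-sumF (summand i))
    where
    summand : ∀ i j → IsLaurent (λ α x → pairSummand (g α x) i j)
    summand i j with i <? j
    ... | yes i<j = g-Laurent i j i<j
    ... | no  _   = [] , λ _ _ _ → refl

  LaurentPoint : (Params n → Point n → Point n) → Set
  LaurentPoint z = ∀ k → IsLaurent (λ α x → z α x k)

  LaurentPoint-setAt : ∀ i {v z} → IsLaurent v → LaurentPoint z → LaurentPoint (λ α x → setAt i (v α x) (z α x))
  LaurentPoint-setAt i v-Laurent z-Laurent k with k ≟ i
  ... | yes _ = v-Laurent
  ... | no  _ = z-Laurent k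

  IsLaurent-P : ∀ {z} → LaurentPoint z → IsLaurent (λ α x → P α (z α x))
  IsLaurent-P z-Laurent = IsLaurent-+
    (IsLaurent-sumF (λ k → IsLaurent-* (z-Laurent k) (z-Laurent k)))
    (IsLaurent-sumPairs (λ k l k<l → IsLaurent-* (IsLaurent-param k<l) (IsLaurent-* (z-Laurent k) (z-Laurent l))))

  IsLaurent-polar : ∀ {u v} → LaurentPoint u → LaurentPoint v → IsLaurent (λ α x → polar α (u α x) (v α x))
  IsLaurent-polar u-Laurent v-Laurent = IsLaurent-+
    (IsLaurent-sumF (λ k → IsLaurent-+ (IsLaurent-* (u-Laurent k) (v-Laurent k)) (IsLaurent-* (v-Laurent k) (u-Laurent k))))
    (IsLaurent-sumPairs (λ k l k<l → IsLaurent-* (IsLaurent-param k<l)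
      (IsLaurent-+ (IsLaurent-* (u-Laurent k) (v-Laurent l)) (IsLaurent-* (v-Laurent k) (u-Laurent l)))))

  LaurentPoint-vietaMove : ∀ i {K z} → IsLaurent K → LaurentPoint z → LaurentPoint (λ α x → vietaMove (K α x) α i (z α x))
  LaurentPoint-vietaMove i {K} {z} K-Laurent z-Laurent = LaurentPoint-setAt i coordinate z-Laurent
    where
    coordinate : IsLaurent (λ α x → K α x * prodF (setAt i 1ℚ (z α x)) - linearCoeff α i (z α x) - z α x i)
    coordinate = IsLaurent-minus
      (IsLaurent-minus
        (IsLaurent-* K-Laurent (IsLaurent-prodF (LaurentPoint-setAt i (IsLaurent-const (+ 1)) z-Laurent)))
        (IsLaurent-polar (LaurentPoint-setAt i (IsLaurent-const (+ 0)) z-Laurent)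
                         (LaurentPoint-setAt i (IsLaurent-const (+ 1)) (λ _ → IsLaurent-const (+ 0)))))
      (z-Laurent i)

  LaurentPoint-vietaOrbit : ∀ is → LaurentPoint (vietaOrbit is)
  LaurentPoint-vietaOrbit []       = IsLaurent-var
  LaurentPoint-vietaOrbit (i ∷ is) = LaurentPoint-vietaMove i
    (IsLaurent-* (IsLaurent-P IsLaurent-var) (IsLaurent-prodF IsLaurent-inv-var))
    (LaurentPoint-vietaOrbit is)

theorem1p10 : (n : ℕ) → 3 ≤ n → (is : List (Fin n)) →
    ∃ λ (L : Fin n → Laurent n) →
      (α : Params n) (x : Point n) → (∀ k → x k ≢ 0ℚ) →
      (y : Point n) → G α is x ≡ just y →
      ∀ j → y j ≡ evalL α x (L j)
theorem1p10 n _ is = proj₁ ∘ orbit , λ α x x≢0 y G≡y j →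
  trans (proj₁ (G-vietaOrbit is α x x≢0 G≡y) j) (proj₂ (orbit j) α x x≢0)
  where
  orbit : LaurentPoint (vietaOrbit is)
  orbit = LaurentPoint-vietaOrbit is
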